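{- Let $P$ be a normal logic program and $S$ a nonempty set of two-valued interpretations of $P$. Then $S$ is a $\subseteq$-minimal supported trap set of $P$ if and only if $\Pi^{I}_{P}\uparrow\alpha_I = S$ for every $I\in S$.
   Context: Fix a first-order language with finitely many constant, function and predicate symbols. A normal logic program (NLP) $P$ is a finite set of rules $p \leftarrow p_1,\dots,p_m, \mathord{\sim} p_{m+1},\dots,\mathord{\sim} p_k$ ($k\ge m\ge 0$). $\mathrm{HB}(P)$ is its Herbrand base (possibly infinite), $\mathrm{gr}(P)$ its ground instantiation; for a ground rule $r$, $\mathrm{bf}(r)=\bigwedge_{v\in B^+(r)}v\wedge\bigwedge_{v\in B^-(r)}\neg v$ with $B^+(r)$, $B^-(r)$ the positive and negative body atoms. Two-valued interpretations are subsets of $\mathrm{HB}(P)$. For a two-valued $I$, $T_P(I)$ is the set of atoms $a$ such that $I$ satisfies $\mathrm{bf}(r)$ for some $r\in\mathrm{gr}(P)$ with head $a$. A nonempty set $S$ of two-valued interpretations is a supported trap set if $\{T_P(J):J\in S\}\subseteq S$; it is $\subseteq$-minimal if no proper subset is a supported trap set. For a two-valued $I$, the supported reachable closure is defined by transfinite recursion: $\Pi^I_P\uparrow 0=\{I\}$, $\Pi^I_P\uparrow(\alpha+1)=\Pi^I_P\uparrow\alpha\cup\{T_P(J): J\in\Pi^I_P\uparrow\alpha\}$, and $\Pi^I_P\uparrow\beta=\bigcup_{\alpha<\beta}\Pi^I_P\uparrow\alpha$ for limit ordinals $\beta$. This is a $\subseteq$-increasing ordinal-indexed family of subsets of the set of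 two-valued interpretations, hence eventually constant; $\alpha_I$ denotes the least ordinal with $\Pi^I_P\uparrow(\alpha_I+1)=\Pi^I_P\uparrow\alpha_I$. -}

module Defs where

open import Level using (Level; 0ℓ) renaming (suc to lsuc)
open import Data.Nat using (ℕ)
open import Data.Fin using (Fin)
open import Data.Vec using (Vec; []; _∷_)
open import Data.List using (List; map)
open import Data.List.Membership.Propositional using (_∈_)
open import Data.List.Relation.Unary.All using (All)
open import Data.Empty using (⊥)
open import Data.Product using (Σ; ∃; _×_; _,_)
open import Data.Sum using (_⊎_)
open import Relation.Nullary using (¬_)
open import Relation.Binary.PropositionalEquality using (_≡_)

record Language : Set where
  field
    nConst  : ℕ
    nFun    : ℕ
    nPred   : ℕ
    funAr   : Fin nFun → ℕ
    predAr  : Fin nPred → ℕ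

Var : Set
Var = ℕ

-- Brouwer ordinals (the family Π stabilises by ω, so countable
-- limits suffice) and their standard order.

data Ord : Set where
  ozero : Ord
  osuc  : Ord → Ord
  olim  : (ℕ → Ord) → Ord

data _≤ₒ_ : Ord → Ord → Set where
  z≤    : ∀ {a} → ozero ≤ₒ a
  s≤s   : ∀ {a b} → a ≤ₒ b → osuc a ≤ₒ osuc b
  ≤lim  : ∀ {a f} n → a ≤ₒ f n → a ≤ₒ olim f
  lim≤  : ∀ {f a} → (∀ n → f n ≤ₒ a) → olim f ≤ₒ a

module _ (L : Language) where
  open Language L

  data Term (V : Set) : Set where
    var : V → Term V
    con : Fin nConst → Term V
    fun : (f : Fin nFun) → Vec (Term V) (funAr f) → Term V

  record Atom (V : Set) : Set where
    constructor atom
    field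
      pred : Fin nPred
      args : Vec (Term V) (predAr pred)

  record Rule (V : Set) : Set where
    constructor rule
    field
      head : Atom V
      pos  : List (Atom V)
      neg  : List (Atom V)

  Program : Set
  Program = List (Rule Var)

  GTerm : Set
  GTerm = Term ⊥

  GAtom : Set
  GAtom = Atom ⊥

  GRule : Set
  GRule = Rule ⊥

  Subst : Set
  Subst = Var → GTerm

  mutual
    substT : Subst → Term Var → GTerm
    substT σ (var x)    = σ x
    substT σ (con c)    = con c
    substT σ (fun f ts) = fun f (substTs σ ts)

    substTs : ∀ {n} → Subst → Vec (Term Var) n → Vec GTerm n
    substTs σ []       = []
    substTs σ (t ∷ ts) = substT σ t ∷ substTs σ ts

  substA : Subst → Atom Var → GAtom
  substA σ (atom p ts) = atom p (substTs σ ts)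

  substR : Subst → Rule Var → GRule
  substR σ (rule h ps ns) = rule (substA σ h) (map (substA σ) ps) (map (substA σ) ns)

  InGr : Program → GRule → Set
  InGr P r = ∃ λ r₀ → r₀ ∈ P × ∃ λ (σ : Subst) → substR σ r₀ ≡ r

  Interp : Set₁
  Interp = GAtom → Set

  SatBody : Interp → GRule → Set
  SatBody I r = All I (Rule.pos r) × All (λ v → ¬ I v) (Rule.neg r)

  T : Program → Interp → Interp
  T P I a = ∃ λ r → InGr P r × Rule.head r ≡ a × SatBody I r

  _≐_ : Interp → Interp → Set
  I ≐ J = ∀ a → (I a → J a) × (J a → I a)

  ISet : Set₂
  ISet = Interp → Set₁

  -- A predicate on interpretations is a genuine set of subsets of HB
  -- iff it respects equality of interpretations.
  Extensional : ISet → Set₁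
  Extensional S = ∀ {I J} → I ≐ J → S I → S J

  _⊆ˢ_ : ISet → ISet → Set₁
  S ⊆ˢ S′ = ∀ I → S I → S′ I

  _≈ˢ_ : ISet → ISet → Set₁
  S ≈ˢ S′ = (S ⊆ˢ S′) × (S′ ⊆ˢ S)

  NonEmpty : ISet → Set₁
  NonEmpty S = ∃ λ I → S I

  SuppTrapSet : Program → ISet → Set₁
  SuppTrapSet P S = NonEmpty S × (∀ J → S J → S (T P J))

  MinSuppTrapSet : Program → ISet → Set₂
  MinSuppTrapSet P S =
    SuppTrapSet P S ×
    (∀ (S′ : ISet) → Extensional S′ → SuppTrapSet P S′ → S′ ⊆ˢ S → S ⊆ˢ S′)

  Π↑ : Program → Interp → Ord → ISet
  Π↑ P I ozero    J = Lift1 (J ≐ I)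
    where
      Lift1 : Set → Set₁
      Lift1 A = Level.Lift (lsuc 0ℓ) A
  Π↑ P I (osuc α) J = Π↑ P I α J ⊎ (∃ λ K → Π↑ P I α K × Level.Lift (lsuc 0ℓ) (J ≐ T P K))
  Π↑ P I (olim f) J = ∃ λ n → Π↑ P I (f n) J

  Stable : Program → Interp → Ord → Set₁
  Stable P I α = Π↑ P I (osuc α) ≈ˢ Π↑ P I α

  IsLeastStable : Program → Interp → Ord → Set₁
  IsLeastStable P I α = Stable P I α × (∀ β → Stable P I β → α ≤ₒ β)

{-# OPTIONS --safe #-}
module Submission where

-- At any stage β where the closure stabilises, Π^I_P ↑ β is the smallest
-- supported trap set containing I: it contains I, is closed under T_P, and is
-- included in every T_P-closed set containing I (by induction on β). So a trap
-- set is minimal exactly when each of its members generates all of it.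

open import Defs
open import Data.Product using (_×_; _,_; proj₁; proj₂)
open import Data.Sum using (inj₁; inj₂)
open import Function.Bundles using (_⇔_; mk⇔)
open import Level using (lift)

module _ (L : Language) where

  ≐-refl : ∀ {I} → _≐_ L I I
  ≐-refl a = (λ x → x) , (λ x → x)

  ≐-sym : ∀ {I J} → _≐_ L I J → _≐_ L J I
  ≐-sym I≐J a = proj₂ (I≐J a) , proj₁ (I≐J a)

  ≐-trans : ∀ {I J K} → _≐_ L I J → _≐_ L J K → _≐_ L I K
  ≐-trans I≐J J≐K a =
    (λ x → proj₁ (J≐K a) (proj₁ (I≐J a) x)) , (λ x → proj₂ (I≐J a) (proj₂ (J≐K a) x))

module _ (L : Language) (P : Program L) where

  TClosed : ISet L → Set₁
  TClosed S = ∀ J → S J → S (T L P J)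

  Π↑-extensional : ∀ I β → Extensional L (Π↑ L P I β)
  Π↑-extensional I ozero    J≐K (lift J≐I) = lift (≐-trans L (≐-sym L J≐K) J≐I)
  Π↑-extensional I (osuc β) J≐K (inj₁ J∈)  = inj₁ (Π↑-extensional I β J≐K J∈)
  Π↑-extensional I (osuc β) J≐K (inj₂ (M , M∈ , lift J≐TM)) =
    inj₂ (M , M∈ , lift (≐-trans L (≐-sym L J≐K) J≐TM))
  Π↑-extensional I (olim f) J≐K (n , J∈)   = n , Π↑-extensional I (f n) J≐K J∈

  Π↑-seed : ∀ I β → Π↑ L P I β I
  Π↑-seed I ozero    = lift (≐-refl L)
  Π↑-seed I (osuc β) = inj₁ (Π↑-seed I β)
  Π↑-seed I (olim f) = 0 , Π↑-seed I (f 0)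

  Π↑-closed : ∀ {I β} → Stable L P I β → TClosed (Π↑ L P I β)
  Π↑-closed (succ⊆ , _) J J∈ = succ⊆ (T L P J) (inj₂ (J , J∈ , lift (≐-refl L)))

  Π↑-suppTrapSet : ∀ {I β} → Stable L P I β → SuppTrapSet L P (Π↑ L P I β)
  Π↑-suppTrapSet {I} {β} stable = (I , Π↑-seed I β) , Π↑-closed stable

  Π↑-⊆-TClosed : ∀ {S} → Extensional L S → TClosed S
               → ∀ {I} → S I → ∀ β → _⊆ˢ_ L (Π↑ L P I β) S
  Π↑-⊆-TClosed ext closed I∈S ozero    J (lift J≐I) = ext (≐-sym L J≐I) I∈S
  Π↑-⊆-TClosed ext closed I∈S (osuc β) J (inj₁ J∈) = Π↑-⊆-TClosed ext closed I∈S β J J∈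
  Π↑-⊆-TClosed ext closed I∈S (osuc β) J (inj₂ (M , M∈ , lift J≐TM)) =
    ext (≐-sym L J≐TM) (closed M (Π↑-⊆-TClosed ext closed I∈S β M M∈))
  Π↑-⊆-TClosed ext closed I∈S (olim f) J (n , J∈) = Π↑-⊆-TClosed ext closed I∈S (f n) J J∈

  MinSuppTrapSet⇒Π↑≈ : ∀ {S I β} → Extensional L S → Stable L P I β
                     → MinSuppTrapSet L P S → S I → _≈ˢ_ L (Π↑ L P I β) S
  MinSuppTrapSet⇒Π↑≈ {S} {I} {β} ext stable ((_ , closed) , minimal) I∈S =
    Π↑⊆S , minimal (Π↑ L P I β) (Π↑-extensional I β) (Π↑-suppTrapSet stable) Π↑⊆S
    where
    Π↑⊆S : _⊆ˢ_ L (Π↑ L P I β) S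
    Π↑⊆S = Π↑-⊆-TClosed ext closed I∈S β

  Π↑≈⇒MinSuppTrapSet : ∀ {S} (α : Interp L → Ord) → (∀ I → Stable L P I (α I))
                     → NonEmpty L S → (∀ I → S I → _≈ˢ_ L (Π↑ L P I (α I)) S)
                     → MinSuppTrapSet L P S
  Π↑≈⇒MinSuppTrapSet {S} α stable nonEmpty Π↑≈S = (nonEmpty , closed) , minimal
    where
    closed : TClosed S
    closed J J∈S = proj₁ (Π↑≈S J J∈S) (T L P J)
                         (Π↑-closed (stable J) J (Π↑-seed J (α J)))

    minimal : ∀ S′ → Extensional L S′ → SuppTrapSet L P S′ → _⊆ˢ_ L S′ S → _⊆ˢ_ L S S′
    minimal S′ ext′ ((I , I∈S′) , closed′) S′⊆S J J∈S =
      Π↑-⊆-TClosed ext′ closed′ I∈S′ (α I) J (proj₂ (Π↑≈S I (S′⊆S I I∈S′)) J J∈S)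

theoremB2 : (L : Language) (P : Program L) (S : ISet L)
    → Extensional L S → NonEmpty L S
    → (α : Interp L → Ord) → (∀ I → IsLeastStable L P I (α I))
    → MinSuppTrapSet L P S ⇔ (∀ I → S I → _≈ˢ_ L (Π↑ L P I (α I)) S)
theoremB2 L P S ext nonEmpty α leastStable =
  mk⇔ (λ minimal I I∈S → MinSuppTrapSet⇒Π↑≈ L P ext (stable I) minimal I∈S)
      (Π↑≈⇒MinSuppTrapSet L P α stable nonEmpty)
  where
  stable : ∀ I → Stable L P I (α I)
  stable I = proj₁ (leastStable I)
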